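{- Let $S=(N,M_0)$ be a Petri net system such that for every potentially reachable marking $M\in PR(S)$, the system $(N,M)$ is live and reversible. Then the reverse system $-S$ is live and reversible.
   Context: A Petri net is $N=(P,T,W)$ with finite disjoint sets $P$, $T$ and $W:(P\times T)\cup(T\times P)\to\mathbb{N}$. A marking is $M\in\mathbb{N}^P$; a system is $(N,M_0)$. The incidence matrix $I\in\mathbb{Z}^{P\times T}$ is $I(p,t)=W(t,p)-W(p,t)$. A transition $t$ is enabled at $M$ if $M(p)\ge W(p,t)$ for all $p$, and firing it leads to $M+I(\cdot,t)$. $R(N,M)$ is the set of markings reachable from $M$ by finite firing sequences. $PR(S)=\{M\in\mathbb{N}^P\mid \exists Y\in\mathbb{N}^T,\ M=M_0+I\cdot Y\}$ is the set of potentially reachable markings. A system is live if for every transition $t$ and every reachable marking $M$, some marking reachable from $M$ enables $t$; it is reversible if the initial marking is reachable from every reachable marking. The reverse net $-N$ is obtained by reversing all arcs while keeping weights ($W_{ -N}(p,t)=W(t,p)$, $W_{ -N}(t,p)=W(p,t)$), and $-S=(-N,M_0)$. -}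

module Defs where

open import Data.Nat using (ℕ; zero; suc; _≤_)
open import Data.Integer as ℤ using (ℤ; +_)
open import Data.Fin using (Fin; zero; suc)
open import Data.Product using (Σ; ∃; _×_; _,_)
open import Relation.Binary.PropositionalEquality using (_≡_)

Σℤ : (n : ℕ) → (Fin n → ℤ) → ℤ
Σℤ zero    f = + 0
Σℤ (suc n) f = f zero ℤ.+ Σℤ n (λ i → f (suc i))

record Net (np nt : ℕ) : Set where
  field
    Wpt : Fin np → Fin nt → ℕ
    Wtp : Fin nt → Fin np → ℕ
open Net public

Marking : ℕ → Set
Marking np = Fin np → ℕ

reverse : ∀ {np nt} → Net np nt → Net np nt
reverse N = record { Wpt = λ p t → Wtp N t p ; Wtp = λ t p → Wpt N p t }

incidence : ∀ {np nt} → Net np nt → Fin np → Fin nt → ℤ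
incidence N p t = + (Wtp N t p) ℤ.- + (Wpt N p t)

Enabled : ∀ {np nt} → Net np nt → Marking np → Fin nt → Set
Enabled N M t = ∀ p → Wpt N p t ≤ M p

data Fires {np nt} (N : Net np nt) (M : Marking np) (t : Fin nt) (M' : Marking np) : Set where
  fire : Enabled N M t → (∀ p → + (M' p) ≡ + (M p) ℤ.+ incidence N p t) → Fires N M t M'

data Reach {np nt} (N : Net np nt) (M : Marking np) : Marking np → Set where
  here : Reach N M M
  step : ∀ {M' M''} (t : Fin nt) → Reach N M M' → Fires N M' t M'' → Reach N M M''

PR : ∀ {np nt} → Net np nt → Marking np → Marking np → Set
PR {np} {nt} N M0 M =
  Σ (Fin nt → ℕ) λ Y → ∀ p → + (M p) ≡ + (M0 p) ℤ.+ Σℤ nt (λ t → incidence N p t ℤ.* + (Y t))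

Live : ∀ {np nt} → Net np nt → Marking np → Set
Live {np} {nt} N M0 =
  ∀ (t : Fin nt) (M : Marking np) → Reach N M0 M →
    Σ (Marking np) λ M' → Reach N M M' × Enabled N M' t

Reversible : ∀ {np nt} → Net np nt → Marking np → Set
Reversible N M0 = ∀ M → Reach N M0 M → Reach N M M0

-- Under the hypothesis, R(S) is closed under predecessors: if M' fires t to M ∈ R(S), then
-- liveness and reversibility of S give a cycle M0 →* M →* A →t B →* M0 →* M whose firing
-- count, with one occurrence of t removed, solves the state equation of M', so M' ∈ PR(S).
-- Hence (N, M') is reversible and M' ∈ R(S). Consequently every marking from which M0 is
-- reachable is reachable from M0, which is exactly reversibility of -S; liveness of -S
-- follows by returning to M0 and then reaching, backwards, a marking just after t fired.
module Submission where

open import Defs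
open import Data.Nat as ℕ using (ℕ; zero; suc; _∸_)
import Data.Nat.Properties as ℕP
open import Data.Integer using (ℤ; +_; _+_; _*_; -_; _-_)
open import Data.Integer.Properties
  using (+-injective; pos-+; ⊖-≥; m-n≡m⊖n; +-assoc; +-comm; +-identityˡ; +-identityʳ;
         *-identityʳ; *-zeroʳ; *-distribˡ-+; +-0-commutativeMonoid; +-0-abelianGroup)
open import Data.Integer.Tactic.RingSolver using (solve-∀)
open import Algebra.Properties.CommutativeMonoid.Sum +-0-commutativeMonoid
  using (sum; sum-cong-≗; sum-replicate-zero; ∑-distrib-+)
open import Algebra.Properties.AbelianGroup +-0-abelianGroup
  using (∙-cancelʳ; x≈z//y; ⁻¹-anti-homo‿-)
open import Data.Fin using (Fin; zero; suc)
open import Data.Vec.Functional using (replicate; zipWith)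
open import Data.Product using (Σ; _×_; _,_; proj₂)
open import Function using (_∘_)
open import Relation.Binary.PropositionalEquality
open ≡-Reasoning

Σℤ≡sum : ∀ n (f : Fin n → ℤ) → Σℤ n f ≡ sum f
Σℤ≡sum zero    f = refl
Σℤ≡sum (suc n) f = cong (_+_ (f zero)) (Σℤ≡sum n (f ∘ suc))

Σℤ-cong : ∀ n {f g : Fin n → ℤ} → (∀ i → f i ≡ g i) → Σℤ n f ≡ Σℤ n g
Σℤ-cong n {f} {g} f≗g = trans (Σℤ≡sum n f) (trans (sum-cong-≗ f≗g) (sym (Σℤ≡sum n g)))

Σℤ-zero : ∀ n {f : Fin n → ℤ} → (∀ i → f i ≡ + 0) → Σℤ n f ≡ + 0
Σℤ-zero n {f} f≗0 = trans (Σℤ≡sum n f) (trans (sum-cong-≗ f≗0) (sum-replicate-zero n))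

Σℤ-distrib-+ : ∀ n (f g : Fin n → ℤ) → Σℤ n (λ i → f i + g i) ≡ Σℤ n f + Σℤ n g
Σℤ-distrib-+ n f g = begin
  Σℤ n (λ i → f i + g i) ≡⟨ Σℤ≡sum n _ ⟩
  sum (λ i → f i + g i)  ≡⟨ ∑-distrib-+ f g ⟩
  sum f + sum g          ≡⟨ sym (cong₂ _+_ (Σℤ≡sum n f) (Σℤ≡sum n g)) ⟩
  Σℤ n f + Σℤ n g        ∎

indicator : ∀ {n} → Fin n → Fin n → ℕ
indicator zero    zero    = 1
indicator zero    (suc i) = 0
indicator (suc t) zero    = 0
indicator (suc t) (suc i) = indicator t i

Σℤ-indicator : ∀ n (f : Fin n → ℤ) t → Σℤ n (λ i → f i * + indicator t i) ≡ f t
Σℤ-indicator (suc n) f zero =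
  trans (cong₂ _+_ (*-identityʳ (f zero)) (Σℤ-zero n (*-zeroʳ ∘ f ∘ suc))) (+-identityʳ (f zero))
Σℤ-indicator (suc n) f (suc t) =
  trans (cong₂ _+_ (*-zeroʳ (f zero)) (Σℤ-indicator n (f ∘ suc) t)) (+-identityˡ (f (suc t)))

pos-∸-+ : ∀ {a w} v → w ℕ.≤ a → + (a ∸ w ℕ.+ v) ≡ + a + (+ v - + w)
pos-∸-+ {a} {w} v w≤a = begin
  + (a ∸ w ℕ.+ v)     ≡⟨ pos-+ (a ∸ w) v ⟩
  + (a ∸ w) + + v     ≡⟨ cong (_+ + v) (trans (sym (⊖-≥ w≤a)) (sym (m-n≡m⊖n a w))) ⟩
  (+ a - + w) + + v   ≡⟨ +-assoc (+ a) (- + w) (+ v) ⟩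
  + a + (- + w + + v) ≡⟨ cong (_+_ (+ a)) (+-comm (- + w) (+ v)) ⟩
  + a + (+ v - + w)   ∎

+-exchange : ∀ a b c d → ((a + b) + c) + d ≡ (a + (b + d)) + c
+-exchange = solve-∀

module _ {np nt : ℕ} (N : Net np nt) where

  effect : (Fin nt → ℕ) → Fin np → ℤ
  effect Y p = Σℤ nt (λ t → incidence N p t * + Y t)

  -- B = A + I·Y, so that PR N M0 M is definitionally Σ Y (StateEquation M0 Y M).
  StateEquation : Marking np → (Fin nt → ℕ) → Marking np → Set
  StateEquation A Y B = ∀ p → + B p ≡ + A p + effect Y p

  effect-zipWith : ∀ X Z p → effect (zipWith ℕ._+_ X Z) p ≡ effect X p + effect Z p
  effect-zipWith X Z p = begin
    effect (zipWith ℕ._+_ X Z) p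
      ≡⟨ Σℤ-cong nt (λ t → trans (cong (incidence N p t *_) (pos-+ (X t) (Z t)))
                                 (*-distribˡ-+ (incidence N p t) (+ X t) (+ Z t))) ⟩
    Σℤ nt (λ t → incidence N p t * + X t + incidence N p t * + Z t)
      ≡⟨ Σℤ-distrib-+ nt _ _ ⟩
    effect X p + effect Z p ∎

  state-equation-refl : ∀ {A} → StateEquation A (replicate nt 0) A
  state-equation-refl {A} p =
    sym (trans (cong (_+_ (+ A p)) (Σℤ-zero nt (*-zeroʳ ∘ incidence N p))) (+-identityʳ (+ A p)))

  state-equation-fires : ∀ {A t B} → Fires N A t B → StateEquation A (indicator t) B
  state-equation-fires {A} {t} (fire _ A→B) p =
    trans (A→B p) (cong (_+_ (+ A p)) (sym (Σℤ-indicator nt (incidence N p) t)))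

  state-equation-trans : ∀ {A X B Z C} → StateEquation A X B → StateEquation B Z C →
                         StateEquation A (zipWith ℕ._+_ X Z) C
  state-equation-trans {A} {X} {B} {Z} {C} A→B B→C p = begin
    + C p                               ≡⟨ B→C p ⟩
    + B p + effect Z p                  ≡⟨ cong (_+ effect Z p) (A→B p) ⟩
    (+ A p + effect X p) + effect Z p   ≡⟨ +-assoc (+ A p) (effect X p) (effect Z p) ⟩
    + A p + (effect X p + effect Z p)   ≡⟨ cong (_+_ (+ A p)) (sym (effect-zipWith X Z p)) ⟩
    + A p + effect (zipWith ℕ._+_ X Z) p ∎

  reach⇒state-equation : ∀ {A B} → Reach N A B → Σ (Fin nt → ℕ) λ Y → StateEquation A Y B
  reach⇒state-equation here = replicate nt 0 , state-equation-refl
  reach⇒state-equation (step t A→B B→C) with reach⇒state-equation A→B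
  ... | Y , A→B′ = zipWith ℕ._+_ Y (indicator t) , state-equation-trans A→B′ (state-equation-fires B→C)

  state-equation-cancel : ∀ {M0 X A t B Z M M′} →
    StateEquation M0 X A → Fires N A t B → StateEquation B Z M → Fires N M′ t M →
    StateEquation M0 (zipWith ℕ._+_ X Z) M′
  state-equation-cancel {M0} {X} {A} {t} {B} {Z} {M} {M′} M0→A (fire _ A→B) B→M (fire _ M′→M) p =
    ∙-cancelʳ (incidence N p t) (+ M′ p) (+ M0 p + effect (zipWith ℕ._+_ X Z) p) (begin
      + M′ p + i                                 ≡⟨ sym (M′→M p) ⟩
      + M p                                      ≡⟨ B→M p ⟩
      + B p + effect Z p                         ≡⟨ cong (_+ effect Z p) (A→B p) ⟩
      (+ A p + i) + effect Z p                   ≡⟨ cong (λ a → (a + i) + effect Z p) (M0→A p) ⟩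
      ((+ M0 p + effect X p) + i) + effect Z p   ≡⟨ +-exchange (+ M0 p) (effect X p) i (effect Z p) ⟩
      (+ M0 p + (effect X p + effect Z p)) + i   ≡⟨ cong (λ e → (+ M0 p + e) + i) (sym (effect-zipWith X Z p)) ⟩
      (+ M0 p + effect (zipWith ℕ._+_ X Z) p) + i ∎)
    where
    i : ℤ
    i = incidence N p t

  fire-enabled : ∀ {A t} → Enabled N A t → Σ (Marking np) (Fires N A t)
  fire-enabled {A} {t} en =
    (λ p → A p ∸ Wpt N p t ℕ.+ Wtp N t p) , fire en (λ p → pos-∸-+ (Wtp N t p) (en p))

  enabled-reverse : ∀ {A t B} → Fires N A t B → Enabled (reverse N) B t
  enabled-reverse {A} {t} {B} (fire en A→B) p =
    subst (Wtp N t p ℕ.≤_) (sym B≡) (ℕP.m≤n+m (Wtp N t p) (A p ∸ Wpt N p t))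
    where
    B≡ : B p ≡ A p ∸ Wpt N p t ℕ.+ Wtp N t p
    B≡ = +-injective (trans (A→B p) (sym (pos-∸-+ (Wtp N t p) (en p))))

  fires-reverse : ∀ {A t B} → Fires N A t B → Fires (reverse N) B t A
  fires-reverse {A} {t} {B} A→B@(fire _ A→B′) = fire (enabled-reverse A→B) λ p →
    trans (x≈z//y (+ A p) (incidence N p t) (+ B p) (sym (A→B′ p)))
          (cong (_+_ (+ B p)) (⁻¹-anti-homo‿- (+ Wtp N t p) (+ Wpt N p t)))

  reach-trans : ∀ {A B C} → Reach N A B → Reach N B C → Reach N A C
  reach-trans A→B here             = A→B
  reach-trans A→B (step t B→C C→D) = step t (reach-trans A→B B→C) C→D

reach-reverse : ∀ {np nt} (N : Net np nt) {A B} → Reach N A B → Reach (reverse N) B A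
reach-reverse N here             = here
reach-reverse N (step t A→B B→C) =
  reach-trans (reverse N) (step t here (fires-reverse N B→C)) (reach-reverse N A→B)

reversible-reverse : ∀ {np nt} (N : Net np nt) (M0 : Marking np) →
  (∀ M → Reach N M M0 → Reach N M0 M) → Reversible (reverse N) M0
reversible-reverse N M0 co-reach M M0→M = reach-reverse N (co-reach M (reach-reverse (reverse N) M0→M))

live-reverse : ∀ {np nt} (N : Net np nt) (M0 : Marking np) →
  Live N M0 → Reversible N M0 → Reversible (reverse N) M0 → Live (reverse N) M0
live-reverse N M0 live rev rev⁻ t M M0→M with live t M0 here
... | A , M0→A , enA with fire-enabled N enA
... | B , A→B =
  B , reach-trans (reverse N) (rev⁻ M M0→M) (reach-reverse N (rev B (step t M0→A A→B))) ,
  enabled-reverse N A→B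

module _ {np nt : ℕ} (N : Net np nt) (M0 : Marking np)
         (live-reversible : ∀ M → PR N M0 M → Live N M × Reversible N M) where

  reach-predecessor : ∀ {M′ t M} → Fires N M′ t M → Reach N M0 M → Reach N M0 M′
  reach-predecessor {M′} {t} {M} M′→M M0→M with live-reversible M0 (reach⇒state-equation N here)
  ... | live , rev with live t M M0→M
  ... | A , M→A , enA with fire-enabled N enA
  ... | B , A→B = reach-trans N M0→M (rev′ M (step t here M′→M))
    where
    M0→A : Reach N M0 A
    M0→A = reach-trans N M0→M M→A
    B→M : Reach N B M
    B→M = reach-trans N (rev B (step t M0→A A→B)) M0→M
    M′∈PR : PR N M0 M′
    M′∈PR with reach⇒state-equation N M0→A | reach⇒state-equation N B→M
    ... | X , eqX | Z , eqZ = zipWith ℕ._+_ X Z , state-equation-cancel N eqX A→B eqZ M′→M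
    rev′ : Reversible N M′
    rev′ = proj₂ (live-reversible M′ M′∈PR)

  reach-backward : ∀ {M M′} → Reach N M M′ → Reach N M0 M′ → Reach N M0 M
  reach-backward here               M0→M′ = M0→M′
  reach-backward (step t M→A A→M′) M0→M′ = reach-backward M→A (reach-predecessor A→M′ M0→M′)

lemma3 : ∀ {np nt : ℕ} (N : Net np nt) (M0 : Marking np) →
    (∀ M → PR N M0 M → Live N M × Reversible N M) →
    Live (reverse N) M0 × Reversible (reverse N) M0
lemma3 N M0 H with H M0 (reach⇒state-equation N here)
... | live , rev = live-reverse N M0 live rev rev⁻ , rev⁻
  where
  rev⁻ : Reversible (reverse N) M0
  rev⁻ = reversible-reverse N M0 (λ M M→M0 → reach-backward N M0 H M→M0 here)
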